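{- Let $S$ be a positive opetope. Then the positive-to-one poset associated with $S$ is a dendritic face complex.
   Context: A positive hypergraph $S$ consists of finite sets $S_k$ ($k\in\mathbb{N}$), all but finitely many empty, and maps $\gamma:S_{k+1}\to S_k$, $\delta:S_{k+1}\to\mathcal{P}(S_k)$ with $\delta(a)\neq\emptyset$ for all $a$ and $\delta(a)$ a singleton for $a\in S_1$; $\dim S=\max\{k:S_k\ne\emptyset\}$. For $a\in S_{k+2}$: $\gamma\gamma(a)=\{\gamma(\gamma(a))\}$, $\gamma\delta(a)=\{\gamma(x):x\in\delta(a)\}$, $\delta\gamma(a)=\delta(\gamma(a))$, $\delta\delta(a)=\bigcup_{x\in\delta(a)}\delta(x)$. For $a,b\in S_k$: $a\triangleleft^+b$ iff there is $\alpha\in S_{k+1}$ with $a\in\delta(\alpha)$, $\gamma(\alpha)=b$; $<^+$ is its transitive closure; for $k\ge1$, $a\triangleleft^-b$ iff $\gamma(a)\in\delta(b)$, and $<^-$ is its transitive closure. Axioms: globularity: for $a\in S_{\ge2}$, $\gamma\gamma(a)=\gamma\delta(a)\setminus\delta\delta(a)$ and $\delta\gamma(a)=\delta\delta(a)\setminus\gamma\delta(a)$; strictness: each $<^+$ on $S_k$ is a strict partial order and $<^+$ on $S_0$ is total; disjointness: for $k>0$, no $a,b\in S_k$ are comparable both for $<^+$ and for $<^-$; pencil linearity: for $k>0$, $x\in S_{k-1}$, the sets $\{a\in S_k:x\in\delta(a)\}$ and $\{a\in S_k:\gamma(a)=x\}$ are linearly ordered by $<^+$. An opetopic cardinal satisfies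 these four axioms; it is principal if for every $0\le k\le\dim S$ the set $S_k\setminus\bigcup_{a\in S_{k+1}}\delta(a)$ has exactly one element; a positive opetope is a principal opetopic cardinal. The POP associated with $S$ has underlying set $\bigsqcup_k S_k$, $\dim(x)=k$ for $x\in S_k$, $y\prec^-x$ iff $y\in\delta(x)$, and $y\prec^+x$ iff $y=\gamma(x)$; write $y\prec x$ for either, and $\le$ for the reflexive-transitive closure of $\prec$; $\gamma(x)$ is the unique $y$ with $y\prec^+x$ and $\delta(x)=\{y:y\prec^-x\}$. A dendritic face complex (DFC) is a positive-to-one poset (a finite set with $\dim$ and relations $\prec^\pm$ such that $y\prec x\Rightarrow\dim x=\dim y+1$, never both $y\prec^-x$ and $y\prec^+x$, and each $x$ with $\dim x\ge1$ has exactly one $\prec^+$-predecessor and at least one $\prec^-$-predecessor) such that: it has a greatest element for $\le$; (oriented thinness) whenever $z\prec^{\beta}y\prec^{\alpha}x$ there is a unique $y'\neq y$ with $z\prec y'\prec x$, and writing $z\prec^{\beta'}y'\prec^{\alpha'}x$ the signs (as $\pm1$) satisfy $\alpha\beta=-\alpha'\beta'$; (acyclicity) $\delta(x)$ is a singleton if $\dim x=1$, $\delta(x)\neq\emptyset$ if $\dim x\ge1$, and for $\dim x\ge1$ there are no $p\ge1$, $y_1,\dots,y_p\in\delta(x)$ with $\gamma(y_{i+1})\in\delta(y_i)$ for $1\le i<p$ and $\gamma(y_1)\in\delta(y_p)$. -}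

module Defs where

open import Data.Nat using (ℕ; zero; suc; _<_; _≤_)
open import Data.Fin using (Fin; zero; suc; inject₁; fromℕ)
open import Data.Fin.Subset using (Subset; _∈_; Nonempty)
open import Data.Product using (Σ; ∃; _×_; _,_; proj₁)
open import Data.Sum using (_⊎_)
open import Data.Sign using (Sign; opposite) renaming (_*_ to _*ₛ_)
import Data.Sign as Sign
open import Relation.Nullary using (¬_)
open import Relation.Binary.PropositionalEquality using (_≡_; _≢_)
open import Relation.Binary.Structures using (IsStrictPartialOrder)
open import Relation.Binary.Construct.Closure.Transitive using (TransClosure)
open import Relation.Binary.Construct.Closure.ReflexiveTransitive using (Star)
open import Function.Bundles using (_⇔_; _↔_)

-- Positive hypergraphs.
-- S_k is represented by Fin (size k); γ k : S_{k+1} → S_k and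
-- δ k : S_{k+1} → P(S_k) (a subset of S_k).

record PositiveHypergraph : Set where
  field
    size          : ℕ → ℕ
    bound         : ℕ
    finiteSupport : ∀ k → bound < k → size k ≡ 0
    γ             : ∀ k → Fin (size (suc k)) → Fin (size k)
    δ             : ∀ k → Fin (size (suc k)) → Subset (size k)
    δ-nonempty    : ∀ k (a : Fin (size (suc k))) → Nonempty (δ k a)
    δ-singleton   : ∀ (a : Fin (size 1)) →
                    ∃ λ (x : Fin (size 0)) → ∀ y → (y ∈ δ 0 a) ⇔ (y ≡ x)

module _ (S : PositiveHypergraph) where
  open PositiveHypergraph S

  IsDim : ℕ → Set
  IsDim d = Fin (size d) × (∀ k → d < k → size k ≡ 0)

  ◁⁺ : ∀ k → Fin (size k) → Fin (size k) → Set
  ◁⁺ k a b = ∃ λ (α : Fin (size (suc k))) → (a ∈ δ k α) × (γ k α ≡ b)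

  <⁺ : ∀ k → Fin (size k) → Fin (size k) → Set
  <⁺ k = TransClosure (◁⁺ k)

  ◁⁻ : ∀ k → Fin (size (suc k)) → Fin (size (suc k)) → Set
  ◁⁻ k a b = γ k a ∈ δ k b

  <⁻ : ∀ k → Fin (size (suc k)) → Fin (size (suc k)) → Set
  <⁻ k = TransClosure (◁⁻ k)

  InΓΔ : ∀ k → Fin (size (suc (suc k))) → Fin (size k) → Set
  InΓΔ k a y = ∃ λ (x : Fin (size (suc k))) → (x ∈ δ (suc k) a) × (γ k x ≡ y)

  InΔΔ : ∀ k → Fin (size (suc (suc k))) → Fin (size k) → Set
  InΔΔ k a y = ∃ λ (x : Fin (size (suc k))) → (x ∈ δ (suc k) a) × (y ∈ δ k x)

  -- Globularity (set equalities stated elementwise)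
  Globularity : Set
  Globularity = ∀ k (a : Fin (size (suc (suc k)))) (y : Fin (size k)) →
    ((y ≡ γ k (γ (suc k) a)) ⇔ (InΓΔ k a y × ¬ InΔΔ k a y))
    × ((y ∈ δ k (γ (suc k) a)) ⇔ (InΔΔ k a y × ¬ InΓΔ k a y))

  Strictness : Set
  Strictness = (∀ k → IsStrictPartialOrder _≡_ (<⁺ k))
             × (∀ (a b : Fin (size 0)) → a ≢ b → <⁺ 0 a b ⊎ <⁺ 0 b a)

  -- Disjointness (for k > 0, i.e. on S_{k+1})
  Disjointness : Set
  Disjointness = ∀ k (a b : Fin (size (suc k))) →
    ¬ ((<⁺ (suc k) a b ⊎ <⁺ (suc k) b a) × (<⁻ k a b ⊎ <⁻ k b a))

  -- Pencil linearity (for k > 0: x ∈ S_k, pencils in S_{k+1})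
  PencilLinearity : Set
  PencilLinearity = ∀ k (x : Fin (size k)) →
    (∀ (a b : Fin (size (suc k))) → x ∈ δ k a → x ∈ δ k b → a ≢ b →
       <⁺ (suc k) a b ⊎ <⁺ (suc k) b a)
    × (∀ (a b : Fin (size (suc k))) → γ k a ≡ x → γ k b ≡ x → a ≢ b →
       <⁺ (suc k) a b ⊎ <⁺ (suc k) b a)

  IsOpetopicCardinal : Set
  IsOpetopicCardinal = Globularity × Strictness × Disjointness × PencilLinearity

  NotInAnySource : ∀ k → Fin (size k) → Set
  NotInAnySource k x = ¬ (∃ λ (a : Fin (size (suc k))) → x ∈ δ k a)

  IsPrincipal : Set
  IsPrincipal = ∃ λ d → IsDim d × (∀ k → k ≤ d →
    ∃ λ (x : Fin (size k)) → NotInAnySource k x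
      × (∀ y → NotInAnySource k y → y ≡ x))

  IsPositiveOpetope : Set
  IsPositiveOpetope = IsOpetopicCardinal × IsPrincipal

record POP : Set₁ where
  field
    Carrier : Set
    dim     : Carrier → ℕ
    _≺⁻_    : Carrier → Carrier → Set
    _≺⁺_    : Carrier → Carrier → Set

module _ (P : POP) where
  open POP P

  _≺[_]_ : Carrier → Sign → Carrier → Set
  y ≺[ Sign.+ ] x = y ≺⁺ x
  y ≺[ Sign.- ] x = y ≺⁻ x

  _≺_ : Carrier → Carrier → Set
  y ≺ x = (y ≺⁻ x) ⊎ (y ≺⁺ x)

  _≤P_ : Carrier → Carrier → Set
  _≤P_ = Star _≺_

  -- "γ(y) ∈ δ(x)", with γ(y) the ≺⁺-predecessor and δ(x) the ≺⁻-predecessors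
  ΓIn : Carrier → Carrier → Set
  ΓIn y x = ∃ λ z → (z ≺⁺ y) × (z ≺⁻ x)

  IsPositiveToOne : Set
  IsPositiveToOne =
      (∃ λ n → Carrier ↔ Fin n)
    × (∀ x y → y ≺ x → dim x ≡ suc (dim y))
    × (∀ x y → ¬ ((y ≺⁻ x) × (y ≺⁺ x)))
    × (∀ x → 1 ≤ dim x → ∃ λ y → (y ≺⁺ x) × (∀ y' → y' ≺⁺ x → y' ≡ y))
    × (∀ x → 1 ≤ dim x → ∃ λ y → y ≺⁻ x)

  HasGreatest : Set
  HasGreatest = ∃ λ t → ∀ x → x ≤P t

  OrientedThinness : Set
  OrientedThinness = ∀ x y z (α β : Sign) → z ≺[ β ] y → y ≺[ α ] x →
    ∃ λ y' → (y' ≢ y) × (z ≺ y') × (y' ≺ x)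
      × (∀ y'' → y'' ≢ y → z ≺ y'' → y'' ≺ x → y'' ≡ y')
      × (∀ (α' β' : Sign) → z ≺[ β' ] y' → y' ≺[ α' ] x →
           α *ₛ β ≡ opposite (α' *ₛ β'))

  Acyclicity : Set
  Acyclicity =
      (∀ x → dim x ≡ 1 → ∃ λ y → ∀ z → (z ≺⁻ x) ⇔ (z ≡ y))
    × (∀ x → 1 ≤ dim x → ∃ λ y → y ≺⁻ x)
    × (∀ x → 1 ≤ dim x → ¬ (∃ λ p → ∃ λ (ys : Fin (suc p) → Carrier) →
          (∀ i → ys i ≺⁻ x)
        × (∀ (i : Fin p) → ΓIn (ys (suc i)) (ys (inject₁ i)))
        × ΓIn (ys zero) (ys (fromℕ p))))

  IsDFC : Set
  IsDFC = IsPositiveToOne × HasGreatest × OrientedThinness × Acyclicity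

module _ (S : PositiveHypergraph) where
  open PositiveHypergraph S

  Elem : Set
  Elem = Σ ℕ (λ k → Fin (size k))

  data _≺⁻S_ : Elem → Elem → Set where
    src : ∀ {k} {a : Fin (size (suc k))} {y : Fin (size k)} →
          y ∈ δ k a → (k , y) ≺⁻S (suc k , a)

  data _≺⁺S_ : Elem → Elem → Set where
    tgt : ∀ {k} (a : Fin (size (suc k))) → (k , γ k a) ≺⁺S (suc k , a)

  assocPOP : POP
  assocPOP = record
    { Carrier = Elem
    ; dim     = proj₁
    ; _≺⁻_    = _≺⁻S_
    ; _≺⁺_    = _≺⁺S_
    }

{-# OPTIONS --safe #-}
module Submission where

-- Oriented thinness is checked on each interval z ≺ · ≺ x with x ∈ S_{k+2}.  By
-- globularity z is either γγx, or in δγx, or in both γδx and δδx; in each case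
-- there are exactly two routes from z to x, and they have opposite orientations.
-- There is no third route because two sources of x sharing a target, or sharing
-- a source, coincide: pencil linearity makes them <⁺-comparable, whereas (by
-- disjointness) no two sources of one cell are.  Acyclicity holds because
-- a <⁻ b implies γa <⁺ γb.  The top cell is reached by climbing dimensions: a
-- cell of dimension k < dim S is a source of a (k+1)-cell unless it is the unique
-- non-source of S_k, and that one is the target of the (k+1)-cell reached by
-- following <⁺ upwards from any target until it stops, which happens as S_k is
-- finite.

open import Defs
open import Data.Nat using (ℕ; zero; suc; _≤_; z≤n; s≤s; _≤‴_; ≤‴-refl; ≤‴-step; _≤?_)
import Data.Nat as ℕ
open import Data.Nat.Properties using (≤-refl; <⇒≤; ≤⇒≤‴; ≤‴⇒≤; ≰⇒>)
open import Data.Fin using (Fin; zero; suc; inject₁; fromℕ)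
open import Data.Fin.Properties using (¬Fin0; any?; +↔⊎) renaming (_≟_ to _≟ᶠ_)
open import Data.Fin.Subset using (_∈_; _∉_)
open import Data.Fin.Subset.Properties using (_∈?_)
open import Data.Fin.Induction using (spo-noetherian)
open import Data.Product using (Σ; ∃; _×_; _,_; proj₁; proj₂; map₁)
open import Data.Product.Properties.WithK using (,-injectiveʳ)
open import Data.Sum using (_⊎_; inj₁; inj₂)
import Data.Sum as Sum
open import Data.Sum.Function.Propositional using (_⊎-↔_)
open import Data.Empty using (⊥-elim)
open import Data.Sign using (Sign; +; -; opposite) renaming (_*_ to _*ₛ_)
open import Data.Sign.Properties using (opposite-selfInverse)
open import Function using (_∘_; flip)
open import Function.Bundles using (_↔_; _⇔_; mk↔ₛ′; Equivalence; mk⇔)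
open import Function.Definitions using (Injective)
open import Function.Properties.Inverse using (↔-refl; ↔-trans; ↔-sym)
open import Induction.WellFounded using (Acc; acc)
open import Relation.Nullary using (¬_; Dec; yes; no)
open import Relation.Nullary.Decidable using (_×-dec_)
open import Relation.Binary.Definitions using (Transitive)
open import Relation.Binary.PropositionalEquality
  using (_≡_; _≢_; refl; sym; trans; cong; ≢-sym)
open import Relation.Binary.Structures using (IsStrictPartialOrder)
open import Relation.Binary.Construct.Closure.Transitive using ([_]; _∷_; _++_)
open import Relation.Binary.Construct.Closure.ReflexiveTransitive using (ε; _◅_)

≡0⇒¬Fin : ∀ {n} → n ≡ 0 → ¬ Fin n
≡0⇒¬Fin refl = ¬Fin0

Σℕ↔⊎ : {P : ℕ → Set} → Σ ℕ P ↔ (P 0 ⊎ Σ ℕ (P ∘ suc))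
Σℕ↔⊎ {P} = mk↔ₛ′ to from
  (λ { (inj₁ _) → refl ; (inj₂ _) → refl })
  (λ { (zero , _) → refl ; (suc _ , _) → refl })
  where
  to : Σ ℕ P → P 0 ⊎ Σ ℕ (P ∘ suc)
  to (zero , p)  = inj₁ p
  to (suc k , p) = inj₂ (k , p)
  from : P 0 ⊎ Σ ℕ (P ∘ suc) → Σ ℕ P
  from (inj₁ p)       = zero , p
  from (inj₂ (k , p)) = suc k , p

Σℕ-finiteSupport↔Fin : ∀ B (f : ℕ → ℕ) → (∀ k → B ≤ k → f k ≡ 0) →
                       ∃ λ n → Σ ℕ (Fin ∘ f) ↔ Fin n
Σℕ-finiteSupport↔Fin zero f vanish =
  0 , mk↔ₛ′ empty (λ ()) (λ ()) (⊥-elim ∘ ¬Fin0 ∘ empty)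
  where
  empty : Σ ℕ (Fin ∘ f) → Fin 0
  empty (k , i) = ⊥-elim (≡0⇒¬Fin (vanish k z≤n) i)
Σℕ-finiteSupport↔Fin (suc B) f vanish
  with Σℕ-finiteSupport↔Fin B (f ∘ suc) (λ k B≤k → vanish (suc k) (s≤s B≤k))
... | n , tail↔ =
  f 0 ℕ.+ n , ↔-trans Σℕ↔⊎ (↔-trans (↔-refl ⊎-↔ tail↔) (↔-sym +↔⊎))

closedChain⇒loop : ∀ {A : Set} {R : A → A → Set} → Transitive R →
                   ∀ p (ys : Fin (suc p) → A) →
                   (∀ i → R (ys (suc i)) (ys (inject₁ i))) →
                   R (ys zero) (ys (fromℕ p)) → R (ys zero) (ys zero)
closedChain⇒loop R-trans zero    ys steps closing = closing
closedChain⇒loop {R = R} R-trans (suc p) ys steps closing =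
  closedChain⇒loop {R = R} R-trans p (ys ∘ inject₁) (steps ∘ inject₁)
    (R-trans closing (steps (fromℕ p)))

record ThinDiamond {Y : Set} (Route : Y → Sign → Sign → Set) : Set where
  field
    y₁ y₂                : Y
    α₁ β₁ α₂ β₂          : Sign
    route₁               : Route y₁ α₁ β₁
    route₂               : Route y₂ α₂ β₂
    y₁≢y₂                : y₁ ≢ y₂
    opposite-orientation : α₁ *ₛ β₁ ≡ opposite (α₂ *ₛ β₂)
    only                 : ∀ {y α β} → Route y α β →
                             (y , α , β) ≡ (y₁ , α₁ , β₁)
                           ⊎ (y , α , β) ≡ (y₂ , α₂ , β₂)

module _ {Y : Set} {Route : Y → Sign → Sign → Set} where

  ThinDiamond-swap : ThinDiamond Route → ThinDiamond Route
  ThinDiamond-swap D = record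
    { y₁ = y₂ ; y₂ = y₁ ; α₁ = α₂ ; β₁ = β₂ ; α₂ = α₁ ; β₂ = β₁
    ; route₁ = route₂ ; route₂ = route₁
    ; y₁≢y₂ = ≢-sym y₁≢y₂
    ; opposite-orientation = sym (opposite-selfInverse (sym opposite-orientation))
    ; only = Sum.swap ∘ only
    }
    where open ThinDiamond D

  ThinDiamond-map : ∀ {Y′} {Route′ : Y′ → Sign → Sign → Set} (f : Y → Y′) →
                    Injective _≡_ _≡_ f →
                    (∀ {y α β} → Route y α β → Route′ (f y) α β) →
                    (∀ {y′ α β} → Route′ y′ α β →
                       ∃ λ y → f y ≡ y′ × Route y α β) →
                    ThinDiamond Route → ThinDiamond Route′
  ThinDiamond-map {Route′ = Route′} f f-injective to from D = record
    { y₁ = f y₁ ; y₂ = f y₂ ; α₁ = α₁ ; β₁ = β₁ ; α₂ = α₂ ; β₂ = β₂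
    ; route₁ = to route₁ ; route₂ = to route₂
    ; y₁≢y₂ = y₁≢y₂ ∘ f-injective
    ; opposite-orientation = opposite-orientation
    ; only = only′
    }
    where
    open ThinDiamond D
    only′ : ∀ {y′ α β} → Route′ y′ α β →
              (y′ , α , β) ≡ (f y₁ , α₁ , β₁)
            ⊎ (y′ , α , β) ≡ (f y₂ , α₂ , β₂)
    only′ r′ with from r′
    ... | _ , refl , r = Sum.map (cong (map₁ f)) (cong (map₁ f)) (only r)

module _ (P : POP) where
  open POP P

  record Route (z x y : Carrier) (α β : Sign) : Set where
    constructor route
    field
      lower : _≺[_]_ P z β y
      upper : _≺[_]_ P y α x

  ThinPartner : (x y z : Carrier) (α β : Sign) → Set
  ThinPartner x y z α β = ∃ λ y′ → (y′ ≢ y) × (_≺_ P z y′) × (_≺_ P y′ x)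
    × (∀ y″ → y″ ≢ y → _≺_ P z y″ → _≺_ P y″ x → y″ ≡ y′)
    × (∀ (α′ β′ : Sign) → _≺[_]_ P z β′ y′ → _≺[_]_ P y′ α′ x →
         α *ₛ β ≡ opposite (α′ *ₛ β′))

  ≺[]⇒≺ : ∀ {u v β} → _≺[_]_ P u β v → _≺_ P u v
  ≺[]⇒≺ {β = - } = inj₁
  ≺[]⇒≺ {β = + } = inj₂

  ≺⇒≺[] : ∀ {u v} → _≺_ P u v → ∃ λ β → _≺[_]_ P u β v
  ≺⇒≺[] (inj₁ u≺⁻v) = - , u≺⁻v
  ≺⇒≺[] (inj₂ u≺⁺v) = + , u≺⁺v

  ThinDiamond⇒ThinPartner₁ : ∀ {z x} (D : ThinDiamond (Route z x)) →
                             let open ThinDiamond D in ThinPartner x y₁ z α₁ β₁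
  ThinDiamond⇒ThinPartner₁ {z} {x} D =
      y₂ , ≢-sym y₁≢y₂
    , ≺[]⇒≺ {β = β₂} (Route.lower route₂)
    , ≺[]⇒≺ {β = α₂} (Route.upper route₂)
    , unique , orientation
    where
    open ThinDiamond D
    unique : ∀ y → y ≢ y₁ → _≺_ P z y → _≺_ P y x → y ≡ y₂
    unique y y≢y₁ z≺y y≺x with ≺⇒≺[] z≺y | ≺⇒≺[] y≺x
    ... | β , z≺y′ | α , y≺x′ with only (route {α = α} {β} z≺y′ y≺x′)
    ...   | inj₁ e = ⊥-elim (y≢y₁ (cong proj₁ e))
    ...   | inj₂ e = cong proj₁ e
    orientation : ∀ α β → _≺[_]_ P z β y₂ → _≺[_]_ P y₂ α x →
                  α₁ *ₛ β₁ ≡ opposite (α *ₛ β)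
    orientation α β z≺y₂ y₂≺x with only (route {α = α} {β} z≺y₂ y₂≺x)
    ... | inj₁ e    = ⊥-elim (y₁≢y₂ (sym (cong proj₁ e)))
    ... | inj₂ refl = opposite-orientation

  ThinDiamond⇒ThinPartner : ∀ {z x y α β} → ThinDiamond (Route z x) →
                            Route z x y α β → ThinPartner x y z α β
  ThinDiamond⇒ThinPartner D r with ThinDiamond.only D r
  ... | inj₁ refl = ThinDiamond⇒ThinPartner₁ D
  ... | inj₂ refl = ThinDiamond⇒ThinPartner₁ (ThinDiamond-swap D)

  thinDiamonds⇒orientedThinness :
    (∀ {z x y α β} → Route z x y α β → ThinDiamond (Route z x)) → OrientedThinness P
  thinDiamonds⇒orientedThinness diamond x y z α β z≺y y≺x = partner (route z≺y y≺x)
    where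
    partner : Route z x y α β → ThinPartner x y z α β
    partner r = ThinDiamond⇒ThinPartner (diamond r) r

module _ (S : PositiveHypergraph) where
  open PositiveHypergraph S
  open POP (assocPOP S) using (_≺⁻_; _≺⁺_)

  private
    P : POP
    P = assocPOP S

  Face : ∀ k → Sign → Fin (size (suc k)) → Fin (size k) → Set
  Face k + y z = γ k y ≡ z
  Face k - y z = z ∈ δ k y

  record Flank {k} (a : Fin (size (suc (suc k)))) (z : Fin (size k))
               (y : Fin (size (suc k))) (α β : Sign) : Set where
    constructor flank
    field
      upper : Face (suc k) α a y
      lower : Face k β y z

  Face⇒≺ : ∀ {k β y z} → Face k β y z → _≺[_]_ P (k , z) β (suc k , y)
  Face⇒≺ {β = + } {y} refl = tgt y
  Face⇒≺ {β = - } z∈δy     = src z∈δy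

  data FaceView (β : Sign) : Elem S → Elem S → Set where
    face : ∀ {k y z} → Face k β y z → FaceView β (k , z) (suc k , y)

  ≺⇒FaceView : ∀ {u v β} → _≺[_]_ P u β v → FaceView β u v
  ≺⇒FaceView {β = + } (tgt y)    = face refl
  ≺⇒FaceView {β = - } (src z∈δy) = face z∈δy

  data RouteView (α β : Sign) : Elem S → Elem S → Elem S → Set where
    flankView : ∀ {k} {a : Fin (size (suc (suc k)))} {y z} → Flank a z y α β →
                RouteView α β (k , z) (suc (suc k) , a) (suc k , y)

  Route⇒RouteView : ∀ {z x y α β} → Route P z x y α β → RouteView α β z x y
  Route⇒RouteView {α = α} {β} (route z≺y y≺x)
    with ≺⇒FaceView {β = β} z≺y | ≺⇒FaceView {β = α} y≺x
  ... | face z∂y | face y∂x = flankView (flank y∂x z∂y)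

  Flank⇒Route : ∀ {k} {a : Fin (size (suc (suc k)))} {z y α β} → Flank a z y α β →
                Route P (k , z) (suc (suc k) , a) (suc k , y) α β
  Flank⇒Route (flank y∂a z∂y) = route (Face⇒≺ z∂y) (Face⇒≺ y∂a)

  Route⇒Flank : ∀ {k} {a : Fin (size (suc (suc k)))} {z y′ α β} →
                Route P (k , z) (suc (suc k) , a) y′ α β →
                ∃ λ y → (suc k , y) ≡ y′ × Flank a z y α β
  Route⇒Flank r with Route⇒RouteView r
  ... | flankView f = _ , refl , f

  source-exists : ∀ x → 1 ≤ proj₁ x → ∃ λ y → y ≺⁻ x
  source-exists (suc k , a) _ = (k , proj₁ (δ-nonempty k a)) , src (proj₂ (δ-nonempty k a))

  unique-source-of-1-cell : ∀ x → proj₁ x ≡ 1 →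
                            ∃ λ y → ∀ z → (z ≺⁻ x) ⇔ (z ≡ y)
  unique-source-of-1-cell (1 , a) refl with δ-singleton a
  ... | s , s-unique = (0 , s) , λ _ → mk⇔ to from
    where
    to : ∀ {z} → z ≺⁻ (1 , a) → z ≡ (0 , s)
    to (src {y = y} y∈δa) = cong (0 ,_) (Equivalence.to (s-unique y) y∈δa)
    from : ∀ {z} → z ≡ (0 , s) → z ≺⁻ (1 , a)
    from refl = src (Equivalence.from (s-unique s) refl)

  data _⊏⁻_ : Elem S → Elem S → Set where
    lift : ∀ {k a b} → <⁻ S k a b → (suc k , a) ⊏⁻ (suc k , b)

  ⊏⁻-trans : Transitive _⊏⁻_
  ⊏⁻-trans (lift a<b) (lift b<c) = lift (a<b ++ b<c)

  ΓIn⇒⊏⁻ : ∀ {u v} → ΓIn P u v → u ⊏⁻ v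
  ΓIn⇒⊏⁻ (_ , tgt _ , src γu∈δv) = lift [ γu∈δv ]

  module _ (<⁺-irrefl : ∀ k {a} → ¬ <⁺ S k a a) where

    γ∉δ : ∀ k (a : Fin (size (suc k))) → γ k a ∉ δ k a
    γ∉δ k a γa∈δa = <⁺-irrefl k [ (a , γa∈δa , refl) ]

    γ-≢-source : ∀ k {a : Fin (size (suc k))} {w} → w ∈ δ k a → γ k a ≢ w
    γ-≢-source k {a} γa∈δa refl = γ∉δ k a γa∈δa

    target-≢-source : ∀ k {y y′ : Fin (size (suc k))} {z} →
                      γ k y ≡ z → z ∈ δ k y′ → y ≢ y′
    target-≢-source k {y} refl γy∈δy refl = γ∉δ k y γy∈δy

    <⁻⇒<⁺-γ : ∀ k {a b} → <⁻ S k a b → <⁺ S k (γ k a) (γ k b)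
    <⁻⇒<⁺-γ k {b = b} [ γa∈δb ]         = [ (b , γa∈δb , refl) ]
    <⁻⇒<⁺-γ k (_∷_ {y = c} γa∈δc c<⁻b) =
      (c , γa∈δc , refl) ∷ <⁻⇒<⁺-γ k c<⁻b

    <⁻-irrefl : ∀ k {a} → ¬ <⁻ S k a a
    <⁻-irrefl k = <⁺-irrefl k ∘ <⁻⇒<⁺-γ k

    ⊏⁻-irrefl : ∀ {u} → ¬ u ⊏⁻ u
    ⊏⁻-irrefl (lift {k} a<a) = <⁻-irrefl k a<a

    positiveToOne : IsPositiveToOne P
    positiveToOne = Σℕ-finiteSupport↔Fin (suc bound) size finiteSupport
                  , dim-suc , ≺⁻-≺⁺-exclusive , unique-target , source-exists
      where
      dim-suc : ∀ x y → _≺_ P y x → proj₁ x ≡ suc (proj₁ y)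
      dim-suc _ _ (inj₁ (src _)) = refl
      dim-suc _ _ (inj₂ (tgt _)) = refl
      ≺⁻-≺⁺-exclusive : ∀ x y → ¬ (y ≺⁻ x × y ≺⁺ x)
      ≺⁻-≺⁺-exclusive _ _ (src γa∈δa , tgt a) = γ∉δ _ a γa∈δa
      unique-target : ∀ x → 1 ≤ proj₁ x →
                      ∃ λ y → y ≺⁺ x × (∀ y′ → y′ ≺⁺ x → y′ ≡ y)
      unique-target (suc k , a) _ = (k , γ k a) , tgt a , λ { _ (tgt _) → refl }

    acyclicity : Acyclicity P
    acyclicity = unique-source-of-1-cell , source-exists , no-cycle
      where
      no-cycle : ∀ x → 1 ≤ proj₁ x →
                 ¬ (∃ λ p → ∃ λ (ys : Fin (suc p) → Elem S) →
                      (∀ i → ys i ≺⁻ x)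
                    × (∀ (i : Fin p) → ΓIn P (ys (suc i)) (ys (inject₁ i)))
                    × ΓIn P (ys zero) (ys (fromℕ p)))
      -- The cycle need not lie in δ(x): ΓIn embeds in the strict order ⊏⁻.
      no-cycle _ _ (p , ys , _ , steps , closing) = ⊏⁻-irrefl
        (closedChain⇒loop {R = _⊏⁻_} ⊏⁻-trans p ys (ΓIn⇒⊏⁻ ∘ steps) (ΓIn⇒⊏⁻ closing))

    module _ (disjoint : Disjointness S) (pencil : PencilLinearity S) where

      <⁺⇒source-<⁻ : ∀ k {a b} → <⁺ S k a b →
                     ∃ λ α → a ∈ δ k α × (∀ c → b ∈ δ k c → <⁻ S k α c)
      <⁺⇒source-<⁻ k [ (α , a∈δα , refl) ] =
        α , a∈δα , λ _ γα∈δc → [ γα∈δc ]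
      <⁺⇒source-<⁻ k ((α , a∈δα , refl) ∷ γα<⁺b) with <⁺⇒source-<⁻ k γα<⁺b
      ... | β , γα∈δβ , β<⁻ =
        α , a∈δα , λ c b∈δc → γα∈δβ ∷ β<⁻ c b∈δc

      sources-<⁺-incomparable : ∀ k (c : Fin (size (suc k))) {a b} →
                                <⁺ S k a b → a ∈ δ k c → b ∉ δ k c
      sources-<⁺-incomparable k c {a} a<⁺b a∈δc b∈δc with <⁺⇒source-<⁻ k a<⁺b
      ... | α , a∈δα , α<⁻ with α ≟ᶠ c
      ...   | yes refl = <⁻-irrefl k (α<⁻ α b∈δc)
      ...   | no α≢c   =
        disjoint k α c ( proj₁ (pencil k a) α c a∈δα a∈δc α≢c
                       , inj₁ (α<⁻ c b∈δc))

      comparable-sources-≡ : ∀ k (x : Fin (size (suc (suc k)))) {y y′} →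
                             y ∈ δ (suc k) x → y′ ∈ δ (suc k) x →
                             (y ≢ y′ → <⁺ S (suc k) y y′ ⊎ <⁺ S (suc k) y′ y) →
                             y ≡ y′
      comparable-sources-≡ k x {y} {y′} y∈δx y′∈δx comparable with y ≟ᶠ y′
      ... | yes y≡y′ = y≡y′
      ... | no y≢y′ with comparable y≢y′
      ...   | inj₁ y<y′ = ⊥-elim (sources-<⁺-incomparable (suc k) x y<y′ y∈δx y′∈δx)
      ...   | inj₂ y′<y = ⊥-elim (sources-<⁺-incomparable (suc k) x y′<y y′∈δx y∈δx)

      sources-sharing-target-≡ : ∀ k (x : Fin (size (suc (suc k)))) {y y′ z} →
                                 y ∈ δ (suc k) x → y′ ∈ δ (suc k) x →
                                 γ k y ≡ z → γ k y′ ≡ z → y ≡ y′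
      sources-sharing-target-≡ k x {y} {y′} {z} y∈δx y′∈δx γy≡z γy′≡z =
        comparable-sources-≡ k x y∈δx y′∈δx
          (proj₂ (pencil k z) y y′ γy≡z γy′≡z)

      sources-sharing-source-≡ : ∀ k (x : Fin (size (suc (suc k)))) {y y′ z} →
                                 y ∈ δ (suc k) x → y′ ∈ δ (suc k) x →
                                 z ∈ δ k y → z ∈ δ k y′ → y ≡ y′
      sources-sharing-source-≡ k x {y} {y′} {z} y∈δx y′∈δx z∈δy z∈δy′ =
        comparable-sources-≡ k x y∈δx y′∈δx
          (proj₁ (pencil k z) y y′ z∈δy z∈δy′)

      module _ (globular : Globularity S) {k} (a : Fin (size (suc (suc k)))) (z : Fin (size k))
        where

        γγ⇒γδ∖δδ : z ≡ γ k (γ (suc k) a) → InΓΔ S k a z × ¬ InΔΔ S k a z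
        γγ⇒γδ∖δδ = Equivalence.to (proj₁ (globular k a z))

        γδ∖δδ⇒γγ : InΓΔ S k a z × ¬ InΔΔ S k a z → z ≡ γ k (γ (suc k) a)
        γδ∖δδ⇒γγ = Equivalence.from (proj₁ (globular k a z))

        δγ⇒δδ∖γδ : z ∈ δ k (γ (suc k) a) → InΔΔ S k a z × ¬ InΓΔ S k a z
        δγ⇒δδ∖γδ = Equivalence.to (proj₂ (globular k a z))

        δδ∖γδ⇒δγ : InΔΔ S k a z × ¬ InΓΔ S k a z → z ∈ δ k (γ (suc k) a)
        δδ∖γδ⇒δγ = Equivalence.from (proj₂ (globular k a z))

        InΓΔ? : Dec (InΓΔ S k a z)
        InΓΔ? = any? (λ w → (w ∈? δ (suc k) a) ×-dec (γ k w ≟ᶠ z))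

        InΔΔ? : Dec (InΔΔ S k a z)
        InΔΔ? = any? (λ w → (w ∈? δ (suc k) a) ×-dec (z ∈? δ k w))

        Flank⇒γδ⊎δδ : ∀ {y α β} → Flank a z y α β → InΓΔ S k a z ⊎ InΔΔ S k a z
        Flank⇒γδ⊎δδ {α = + } { + } (flank refl γγa≡z) = inj₁ (proj₁ (γγ⇒γδ∖δδ (sym γγa≡z)))
        Flank⇒γδ⊎δδ {α = + } { - } (flank refl z∈δγa) = inj₂ (proj₁ (δγ⇒δδ∖γδ z∈δγa))
        Flank⇒γδ⊎δδ {α = - } { + } (flank y∈δa γy≡z)  = inj₁ (_ , y∈δa , γy≡z)
        Flank⇒γδ⊎δδ {α = - } { - } (flank y∈δa z∈δy)  = inj₂ (_ , y∈δa , z∈δy)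

        thinDiamond-γγ : ∀ w → w ∈ δ (suc k) a → γ k w ≡ z → ¬ InΔΔ S k a z →
                         ThinDiamond (Flank a z)
        thinDiamond-γγ w w∈δa γw≡z ¬δδ = record
          { y₁ = γ (suc k) a ; α₁ = + ; β₁ = +
          ; y₂ = w           ; α₂ = - ; β₂ = +
          ; route₁ = flank refl (sym (γδ∖δδ⇒γγ ((w , w∈δa , γw≡z) , ¬δδ)))
          ; route₂ = flank w∈δa γw≡z
          ; y₁≢y₂ = γ-≢-source (suc k) w∈δa
          ; opposite-orientation = refl
          ; only = only
          }
          where
          only : ∀ {y α β} → Flank a z y α β →
                 (y , α , β) ≡ (γ (suc k) a , + , +) ⊎ (y , α , β) ≡ (w , - , +)
          only {α = + } { + } (flank refl _)     = inj₁ refl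
          only {α = + } { - } (flank refl z∈δγa) = ⊥-elim (¬δδ (proj₁ (δγ⇒δδ∖γδ z∈δγa)))
          only {α = - } { + } (flank y∈δa γy≡z)  =
            inj₂ (cong (_, _) (sources-sharing-target-≡ k a y∈δa w∈δa γy≡z γw≡z))
          only {α = - } { - } (flank y∈δa z∈δy)  = ⊥-elim (¬δδ (_ , y∈δa , z∈δy))

        thinDiamond-δγ : ∀ w → w ∈ δ (suc k) a → z ∈ δ k w → ¬ InΓΔ S k a z →
                         ThinDiamond (Flank a z)
        thinDiamond-δγ w w∈δa z∈δw ¬γδ = record
          { y₁ = γ (suc k) a ; α₁ = + ; β₁ = -
          ; y₂ = w           ; α₂ = - ; β₂ = -
          ; route₁ = flank refl (δδ∖γδ⇒δγ ((w , w∈δa , z∈δw) , ¬γδ))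
          ; route₂ = flank w∈δa z∈δw
          ; y₁≢y₂ = γ-≢-source (suc k) w∈δa
          ; opposite-orientation = refl
          ; only = only
          }
          where
          only : ∀ {y α β} → Flank a z y α β →
                 (y , α , β) ≡ (γ (suc k) a , + , -) ⊎ (y , α , β) ≡ (w , - , -)
          only {α = + } { + } (flank refl γγa≡z) = ⊥-elim (¬γδ (proj₁ (γγ⇒γδ∖δδ (sym γγa≡z))))
          only {α = + } { - } (flank refl _)     = inj₁ refl
          only {α = - } { + } (flank y∈δa γy≡z)  = ⊥-elim (¬γδ (_ , y∈δa , γy≡z))
          only {α = - } { - } (flank y∈δa z∈δy)  =
            inj₂ (cong (_, _) (sources-sharing-source-≡ k a y∈δa w∈δa z∈δy z∈δw))

        thinDiamond-interior : ∀ w₁ → w₁ ∈ δ (suc k) a → γ k w₁ ≡ z →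
                               ∀ w₂ → w₂ ∈ δ (suc k) a → z ∈ δ k w₂ →
                               ThinDiamond (Flank a z)
        thinDiamond-interior w₁ w₁∈δa γw₁≡z w₂ w₂∈δa z∈δw₂ = record
          { y₁ = w₁ ; α₁ = - ; β₁ = +
          ; y₂ = w₂ ; α₂ = - ; β₂ = -
          ; route₁ = flank w₁∈δa γw₁≡z
          ; route₂ = flank w₂∈δa z∈δw₂
          ; y₁≢y₂ = target-≢-source k γw₁≡z z∈δw₂
          ; opposite-orientation = refl
          ; only = only
          }
          where
          only : ∀ {y α β} → Flank a z y α β →
                 (y , α , β) ≡ (w₁ , - , +) ⊎ (y , α , β) ≡ (w₂ , - , -)
          only {α = + } { + } (flank refl γγa≡z) =
            ⊥-elim (proj₂ (γγ⇒γδ∖δδ (sym γγa≡z)) (w₂ , w₂∈δa , z∈δw₂))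
          only {α = + } { - } (flank refl z∈δγa) =
            ⊥-elim (proj₂ (δγ⇒δδ∖γδ z∈δγa) (w₁ , w₁∈δa , γw₁≡z))
          only {α = - } { + } (flank y∈δa γy≡z)  =
            inj₁ (cong (_, _) (sources-sharing-target-≡ k a y∈δa w₁∈δa γy≡z γw₁≡z))
          only {α = - } { - } (flank y∈δa z∈δy)  =
            inj₂ (cong (_, _) (sources-sharing-source-≡ k a y∈δa w₂∈δa z∈δy z∈δw₂))

        thinDiamond : InΓΔ S k a z ⊎ InΔΔ S k a z → ThinDiamond (Flank a z)
        thinDiamond γδ⊎δδ with InΓΔ? | InΔΔ?
        ... | yes (w₁ , w₁∈δa , γw₁≡z) | yes (w₂ , w₂∈δa , z∈δw₂) =
          thinDiamond-interior w₁ w₁∈δa γw₁≡z w₂ w₂∈δa z∈δw₂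
        ... | yes (w , w∈δa , γw≡z) | no ¬δδ = thinDiamond-γγ w w∈δa γw≡z ¬δδ
        ... | no ¬γδ | yes (w , w∈δa , z∈δw) = thinDiamond-δγ w w∈δa z∈δw ¬γδ
        ... | no ¬γδ | no ¬δδ = ⊥-elim (Sum.[ ¬γδ , ¬δδ ] γδ⊎δδ)

      orientedThinness : Globularity S → OrientedThinness P
      orientedThinness globular = thinDiamonds⇒orientedThinness P Route-thinDiamond
        where
        Route-thinDiamond : ∀ {z x y α β} → Route P z x y α β → ThinDiamond (Route P z x)
        Route-thinDiamond r with Route⇒RouteView r
        ... | flankView {a = a} {z = z} f =
          ThinDiamond-map (suc _ ,_) ,-injectiveʳ Flank⇒Route Route⇒Flank
            (thinDiamond globular a z (Flank⇒γδ⊎δδ globular a z f))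

  module _ (<⁺-isStrictPartialOrder : ∀ k → IsStrictPartialOrder _≡_ (<⁺ S k)) where

    non-source-target-exists : ∀ k → Fin (size (suc k)) →
                               ∃ λ b → NotInAnySource S k (γ k b)
    non-source-target-exists k a =
      ascend a (spo-noetherian (<⁺-isStrictPartialOrder k) (γ k a))
      where
      ascend : ∀ a → Acc (flip (<⁺ S k)) (γ k a) → ∃ λ b → NotInAnySource S k (γ k b)
      ascend a (acc larger) with any? (λ c → γ k a ∈? δ k c)
      ... | yes (c , γa∈δc) = ascend c (larger [ (c , γa∈δc , refl) ])
      ... | no ¬source      = a , ¬source

    hasGreatest : IsPrincipal S → HasGreatest P
    hasGreatest (d , (t , empty-above) , unique-non-source) =
      (d , t) , λ (k , x) → below-top k x
      where
      non-sources-equal : ∀ {k} → k ≤ d → ∀ {x y : Fin (size k)} →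
                          NotInAnySource S k x → NotInAnySource S k y → x ≡ y
      non-sources-equal k≤d ¬x ¬y with unique-non-source _ k≤d
      ... | _ , _ , unique = trans (unique _ ¬x) (sym (unique _ ¬y))

      top-unique : ∀ (x : Fin (size d)) → x ≡ t
      top-unique x = non-sources-equal ≤-refl nothing-above nothing-above
        where
        nothing-above : ∀ {y} → NotInAnySource S d y
        nothing-above (α , _) = ≡0⇒¬Fin (empty-above (suc d) ≤-refl) α

      covered : ∀ {k} → suc k ≤ d → (x : Fin (size k)) →
                ∃ λ a → _≺_ P (k , x) (suc k , a)
      covered {k} k<d x with any? (λ c → x ∈? δ k c)
      ... | yes (c , x∈δc) = c , inj₁ (src x∈δc)
      ... | no ¬source with non-source-target-exists k (proj₁ (unique-non-source (suc k) k<d))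
      ...   | b , ¬γb-source with non-sources-equal (<⇒≤ k<d) ¬γb-source ¬source
      ...     | refl = b , inj₂ (tgt b)

      climb : ∀ {k} → k ≤‴ d → (x : Fin (size k)) → _≤P_ P (k , x) (d , t)
      climb ≤‴-refl x with top-unique x
      ... | refl = ε
      climb (≤‴-step k<d) x with covered (≤‴⇒≤ k<d) x
      ... | a , x≺a = x≺a ◅ climb k<d a

      below-top : ∀ k (x : Fin (size k)) → _≤P_ P (k , x) (d , t)
      below-top k x with k ≤? d
      ... | yes k≤d = climb (≤⇒≤‴ k≤d) x
      ... | no k≰d  = ⊥-elim (≡0⇒¬Fin (empty-above k (≰⇒> k≰d)) x)

mainTheorem2 : ∀ (S : PositiveHypergraph) → IsPositiveOpetope S → IsDFC (assocPOP S)
mainTheorem2 S ((globular , (<⁺-isStrictPartialOrder , _) , disjoint , pencil) , principal) =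
    positiveToOne S <⁺-irrefl
  , hasGreatest S <⁺-isStrictPartialOrder principal
  , orientedThinness S <⁺-irrefl disjoint pencil globular
  , acyclicity S <⁺-irrefl
  where
  <⁺-irrefl : ∀ k {a} → ¬ <⁺ S k a a
  <⁺-irrefl k = IsStrictPartialOrder.irrefl (<⁺-isStrictPartialOrder k) refl
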